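{- Let $m,n\ge1$ be integers and $S=\{00,\ 01^m0,\ 01^n0\}$ (where $1^k$ denotes $k$ consecutive $1$s). The Seeker wins the Renyi-Ulam game with lie restriction $r(S)$ if and only if $\gcd(m,n)=1$.
   Context: For a set $S$ of nonempty binary strings, $r(S)$ is the set of all finite binary strings that contain no element of $S$ as a contiguous substring. Renyi-Ulam game with lie restriction $R$: the Obscurer picks $x\in\{1,\dots,n\}$; on each turn the Seeker asks whether $x$ lies in a chosen subset and the Obscurer answers yes or no. For a candidate $y$, its lie pattern is the binary string whose $i$-th bit is $1$ iff the $i$-th answer is false for $y$. The Obscurer's answers must keep the lie pattern of her number in $R$ after every answer. The Seeker wins for $n$ if he has an adaptive strategy which after finitely many questions guarantees that at most one $y\in\{1,\dots,n\}$ has its lie pattern in $R$. "The Seeker wins" means he wins for every $n\ge1$. -}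

module Defs where

open import Level using (0ℓ)
open import Data.Nat using (ℕ)
open import Data.Bool using (Bool; true; false; _xor_)
open import Data.Fin using (Fin)
open import Data.List using (List; []; _∷_; _++_; [_]; replicate)
open import Data.List.Relation.Unary.All using (All)
open import Data.List.Relation.Binary.Infix.Heterogeneous using (Infix)
open import Relation.Binary.PropositionalEquality using (_≡_)
open import Relation.Nullary using (¬_)

-- Binary strings: lists of bits, 0 = false, 1 = true.
BinStr : Set
BinStr = List Bool

Substring : BinStr → BinStr → Set
Substring s w = Infix _≡_ s w

r : List BinStr → BinStr → Set
r S w = All (λ s → ¬ Substring s w) S

-- A game state with n candidates: the lie pattern of each candidate so far.
State : ℕ → Set
State n = Fin n → BinStr

-- A question is a subset Q of the candidates (Q y = true iff y ∈ Q);
-- an answer is a bit (true = yes). The answer is false for y iff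
-- (answer xor (y ∈ Q)) = true; this bit is appended to y's lie pattern.
update : ∀ {n} → State n → (Fin n → Bool) → Bool → State n
update st Q a y = st y ++ [ a xor Q y ]

AtMostOneAlive : (R : BinStr → Set) → ∀ {n} → State n → Set
AtMostOneAlive R st = ∀ y z → R (st y) → R (st z) → y ≡ z

-- The Seeker has an adaptive strategy from state st which, after finitely
-- many questions, guarantees that at most one candidate is still in R,
-- whatever the Obscurer answers. (Answers that leave no candidate in R are
-- illegal for the Obscurer; they lead immediately to a winning state, so
-- quantifying over all answers is equivalent.)
data SeekerWinsFrom (R : BinStr → Set) {n : ℕ} (st : State n) : Set where
  done : AtMostOneAlive R st → SeekerWinsFrom R st
  ask  : (Q : Fin n → Bool) →
         ((a : Bool) → SeekerWinsFrom R (update st Q a)) →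
         SeekerWinsFrom R st

SeekerWinsFor : (R : BinStr → Set) → ℕ → Set
SeekerWinsFor R n = SeekerWinsFrom R {n} (λ _ → [])

ones : ℕ → BinStr
ones k = replicate k true

S-mn : ℕ → ℕ → List BinStr
S-mn m n = (false ∷ false ∷ []) ∷ (false ∷ ones m ++ [ false ]) ∷ (false ∷ ones n ++ [ false ]) ∷ []

-- Appending a 0 to a lie pattern ending in 0 1ʲ is fatal exactly when j ∈ {0, m, n}.
-- Call k separable if the Seeker can kill one of two candidates whose patterns
-- end in 0 and in 0 1ᵏ: asking about one of them alone, whoever receives the 0
-- dies or restarts a run. Every k ∈ {0, m, n} is separable, and separable
-- numbers are closed under subtraction (first let both runs grow by the same
-- number of 1s), so gcd(m, n) is separable; separability of 1 lets the Seeker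
-- kill one of any two candidates and hence win. Conversely, if d = gcd(m, n) ≠ 1
-- the Obscurer keeps two candidates alive by keeping the lengths of their final
-- runs of 1s incongruent modulo d: since all forbidden lengths are multiples of
-- d, one of the two can always safely take a 0.

module Submission where

open import Defs
open import Data.Nat using (ℕ; _≤_)
open import Data.Nat.GCD using (gcd)
open import Relation.Binary.PropositionalEquality using (_≡_)
open import Function.Bundles using (_⇔_)

open import Data.Bool using (Bool; true; false; not; _xor_)
open import Data.Empty using (⊥; ⊥-elim)
open import Data.Fin using (Fin; zero; suc)
open import Data.Fin.Properties using (_≟_)
open import Data.List using (List; []; _∷_; _++_; [_]; _∷ʳ_; map; foldl; allFin)
open import Data.List.Membership.Propositional using (_∈_)
open import Data.List.Membership.Propositional.Properties using (∈-allFin)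
open import Data.List.Properties using (++-assoc; ∷ʳ-injective; ++-identityʳ; foldl-++; foldl-∷ʳ)
open import Data.List.Relation.Binary.Infix.Heterogeneous using (Infix; here; there; _++ⁱ_; _ⁱ++_)
open import Data.List.Relation.Binary.Infix.Heterogeneous.Properties using (fromPointwise)
import Data.List.Relation.Binary.Pointwise as Pointwise
open import Data.List.Relation.Binary.Prefix.Heterogeneous using (Prefix; []; _∷_)
open import Data.List.Relation.Unary.All using (All; lookup; tabulate; universal; []; _∷_)
import Data.List.Relation.Unary.All as All
open import Data.List.Relation.Unary.All.Properties using (map⁺; map⁻)
open import Data.List.Relation.Unary.Any using (here; there)
open import Data.List.Relation.Unary.Any.Properties using (singleton⁻)
open import Data.Maybe using (Maybe; just; nothing)
import Data.Maybe as Maybe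
open import Data.Nat using (zero; suc; _+_; _<′_; s≤s; z≤n; compare; less; equal; greater)
import Data.Nat.Properties as ℕ
open import Data.Nat.Divisibility using (_∣_; _∣?_; _∣0; ∣m+n∣m⇒∣n; ∣1⇒≡1)
open import Data.Nat.GCD using (GCD; gcd-GCD; gcd[m,n]∣m; gcd[m,n]∣n)
open import Data.Nat.Induction using (<′-Rec; <′-recBuilder)
open import Data.Product using (∃-syntax; _×_; _,_)
open import Data.Sum using (_⊎_; inj₁; inj₂)
import Data.Sum as Sum
open import Data.Unit using (⊤; tt)
open import Function using (_∘_)
open import Function.Bundles using (mk⇔)
open import Induction using (build)
open import Induction.Lexicographic using (_⊗_) renaming ([_⊗_] to ⊗-recBuilder)
open import Relation.Binary.PropositionalEquality
  using (refl; sym; trans; cong; subst; subst₂; _≢_; module ≡-Reasoning)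
open import Relation.Nullary using (¬_; yes; no; does; contradiction)
open import Relation.Nullary.Decidable using (dec-true; dec-false; decidable-stable)

module _ (P : ℕ → Set) (P-∸ : ∀ {a b} → P a → P (a + b) → P b) where

  private
    shift : ∀ m k → suc m + suc k ≡ suc (suc (m + k))
    shift m k = cong suc (ℕ.+-suc m k)

    smaller : ∀ k m → suc k <′ suc (suc (m + k))
    smaller k m = ℕ.≤⇒≤′ (s≤s (s≤s (ℕ.m≤n+m k m)))

    Euclid : ℕ × ℕ → Set
    Euclid (m , n) = P m → P n → ∃[ d ] GCD m n d × P d

    euclid-step : ∀ p → (<′-Rec ⊗ <′-Rec) Euclid p → Euclid p
    euclid-step (zero , n) _ _ pn = n , GCD.base , pn
    euclid-step (suc m , zero) _ pm _ = suc m , GCD.sym GCD.base , pm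
    euclid-step (suc m , suc n) (recʳ , recˡ) pm pn with compare m n
    ... | equal _ = suc m , GCD.refl , pm
    ... | less _ k
      with d , g , pd ← recʳ (smaller k m) pm (P-∸ pm (subst P (sym (shift m k)) pn))
      = d , subst (λ n → GCD (suc m) n d) (shift m k) (GCD.step g) , pd
    ... | greater _ k
      with d , g , pd ← recˡ (smaller k n) (suc n) (P-∸ pn (subst P (sym (shift n k)) pm)) pn
      = d , subst (λ m → GCD m (suc n) d) (shift n k) (GCD.sym (GCD.step (GCD.sym g))) , pd

  gcd-closed : ∀ {m n} → P m → P n → P (gcd m n)
  gcd-closed {m} {n} pm pn
    with d , g , pd ← build (⊗-recBuilder <′-recBuilder <′-recBuilder) Euclid euclid-step (m , n) pm pn
    = subst P (GCD.unique g (gcd-GCD m n)) pd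

Prefix-∷ʳ⁻ : ∀ {s : BinStr} w b → Prefix _≡_ s (w ∷ʳ b) → Prefix _≡_ s w ⊎ s ≡ w ∷ʳ b
Prefix-∷ʳ⁻ [] b [] = inj₁ []
Prefix-∷ʳ⁻ [] b (refl ∷ []) = inj₂ refl
Prefix-∷ʳ⁻ (x ∷ w) b [] = inj₁ []
Prefix-∷ʳ⁻ (x ∷ w) b (refl ∷ p) = Sum.map (refl ∷_) (cong (x ∷_)) (Prefix-∷ʳ⁻ w b p)

Infix-∷ʳ⁻ : ∀ {s : BinStr} w b → Infix _≡_ s (w ∷ʳ b) →
  Infix _≡_ s w ⊎ ∃[ u ] u ++ s ≡ w ∷ʳ b
Infix-∷ʳ⁻ [] b (here p) = Sum.map here ([] ,_) (Prefix-∷ʳ⁻ [] b p)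
Infix-∷ʳ⁻ (x ∷ w) b (here p) = Sum.map here ([] ,_) (Prefix-∷ʳ⁻ (x ∷ w) b p)
Infix-∷ʳ⁻ [] b (there i) = inj₁ i
Infix-∷ʳ⁻ (x ∷ w) b (there i) = Sum.map there (λ (u , e) → x ∷ u , cong (x ∷_) e) (Infix-∷ʳ⁻ w b i)

Infix-suffix : ∀ (u s : BinStr) → Infix _≡_ s (u ++ s)
Infix-suffix u s = u ++ⁱ fromPointwise (Pointwise.refl refl)

block : ℕ → BinStr
block k = false ∷ ones k ++ [ false ]

EndsIn01^ : ℕ → BinStr → Set
EndsIn01^ k w = ∃[ u ] w ≡ u ++ false ∷ ones k

EndsIn01^-∷ʳ-true : ∀ {k w w′} → EndsIn01^ k w → w′ ≡ w ∷ʳ true → EndsIn01^ (suc k) w′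
EndsIn01^-∷ʳ-true {k} (u , refl) refl =
  u , trans (++-assoc u (false ∷ ones k) [ true ]) (cong (λ v → u ++ false ∷ v) (ones-∷ʳ k))
  where
  ones-∷ʳ : ∀ k → ones k ∷ʳ true ≡ true ∷ ones k
  ones-∷ʳ zero = refl
  ones-∷ʳ (suc k) = cong (true ∷_) (ones-∷ʳ k)

block-∷ʳ⁻ : ∀ {k} w b → Substring (block k) (w ∷ʳ b) →
  Substring (block k) w ⊎ (b ≡ false × EndsIn01^ k w)
block-∷ʳ⁻ {k} w b i with Infix-∷ʳ⁻ w b i
... | inj₁ i′ = inj₁ i′
... | inj₂ (u , e)
  with u++01ᵏ≡w , false≡b ← ∷ʳ-injective (u ++ false ∷ ones k) w (trans (++-assoc u _ _) e)
  = inj₂ (sym false≡b , u , sym u++01ᵏ≡w)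

module Blocks (K : List ℕ) where

  R : BinStr → Set
  R = r (map block K)

  r-[] : R []
  r-[] = map⁺ (universal (λ _ → λ { (here ()) }) K)

  r-++⁻ : ∀ w u → R (w ++ u) → R w
  r-++⁻ w u = All.map (λ ¬i i → ¬i (i ⁱ++ u))

  r-∷ʳ-true : ∀ {w} → R w → R (w ∷ʳ true)
  r-∷ʳ-true {w} rw = map⁺ (All.map new-only-at-false (map⁻ rw))
    where
    new-only-at-false : ∀ {k} → ¬ Substring (block k) w → ¬ Substring (block k) (w ∷ʳ true)
    new-only-at-false ¬i i with block-∷ʳ⁻ w true i
    ... | inj₁ i′ = ¬i i′
    ... | inj₂ (() , _)

  r-∷ʳ-false : ∀ {w} → R w → (∀ {k} → k ∈ K → ¬ EndsIn01^ k w) → R (w ∷ʳ false)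
  r-∷ʳ-false {w} rw ¬ends = map⁺ (tabulate no-new)
    where
    no-new : ∀ {k} → k ∈ K → ¬ Substring (block k) (w ∷ʳ false)
    no-new k∈K i with block-∷ʳ⁻ w false i
    ... | inj₁ i′ = lookup (map⁻ rw) k∈K i′
    ... | inj₂ (_ , ends) = ¬ends k∈K ends

  ¬r-∷ʳ-false : ∀ {k w w′} → k ∈ K → EndsIn01^ k w → w′ ≡ w ∷ʳ false → ¬ R w′
  ¬r-∷ʳ-false {k} k∈K (u , refl) refl rw′ =
    lookup (map⁻ rw′) k∈K
      (subst (Substring (block k)) (sym (++-assoc u (false ∷ ones k) [ false ])) (Infix-suffix u _))

stepTrailingOnes : Maybe ℕ → Bool → Maybe ℕ
stepTrailingOnes t true = Maybe.map suc t
stepTrailingOnes _ false = just 0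

-- The number of 1s after the last 0; nothing when there is no 0, in which
-- case no letter appended later can complete a block.
trailingOnes : BinStr → Maybe ℕ
trailingOnes = foldl stepTrailingOnes nothing

trailingOnes-∷ʳ : ∀ w b → trailingOnes (w ∷ʳ b) ≡ stepTrailingOnes (trailingOnes w) b
trailingOnes-∷ʳ w b = foldl-∷ʳ stepTrailingOnes nothing b w

trailingOnes-EndsIn01^ : ∀ {k w} → EndsIn01^ k w → trailingOnes w ≡ just k
trailingOnes-EndsIn01^ {k} (u , refl) = begin
  trailingOnes (u ++ false ∷ ones k)        ≡⟨ foldl-++ stepTrailingOnes nothing u (false ∷ ones k) ⟩
  foldl stepTrailingOnes (just 0) (ones k)  ≡⟨ count-ones k 0 ⟩
  just (k + 0)                              ≡⟨ cong just (ℕ.+-identityʳ k) ⟩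
  just k                                    ∎
  where
  open ≡-Reasoning
  count-ones : ∀ k i → foldl stepTrailingOnes (just i) (ones k) ≡ just (k + i)
  count-ones zero i = refl
  count-ones (suc k) i = trans (count-ones k (suc i)) (cong just (ℕ.+-suc k i))

data Forces {N : ℕ} (P : State N → Set) (st : State N) : Set where
  stop  : P st → Forces P st
  query : (Q : Fin N → Bool) → ((a : Bool) → Forces P (update st Q a)) → Forces P st

forces-bind : ∀ {N} {P P′ : State N → Set} {st} →
  Forces P st → (∀ {st′} → P st′ → Forces P′ st′) → Forces P′ st
forces-bind (stop p) k = k p
forces-bind (query Q f) k = query Q (λ a → forces-bind (f a) k)

forces-map : ∀ {N} {P P′ : State N → Set} {st} →
  (∀ {st′} → P st′ → P′ st′) → Forces P st → Forces P′ st
forces-map f s = forces-bind s (stop ∘ f)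

ask-apart : ∀ {N} {P : State N → Set} {st : State N} {y z} → y ≢ z →
  (∀ b {st′} → st′ y ≡ st y ∷ʳ b → st′ z ≡ st z ∷ʳ not b → Forces P st′) → Forces P st
ask-apart {P = P} {st} {y} {z} y≢z k = query (λ x → does (x ≟ y)) answer
  where
  y∈Q : does (y ≟ y) ≡ true
  y∈Q = dec-true (y ≟ y) refl

  z∉Q : does (z ≟ y) ≡ false
  z∉Q = dec-false (z ≟ y) (y≢z ∘ sym)

  lie-bit : ∀ x a {q q′} → q ≡ q′ → st x ∷ʳ (a xor q) ≡ st x ∷ʳ (a xor q′)
  lie-bit x a = cong (λ q → st x ∷ʳ (a xor q))

  answer : ∀ a → Forces P (update st (λ x → does (x ≟ y)) a)
  answer true = k false (lie-bit y true y∈Q) (lie-bit z true z∉Q)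
  answer false = k true (lie-bit y false y∈Q) (lie-bit z false z∉Q)


_⊑_ : ∀ {N} → State N → State N → Set
st ⊑ st′ = ∀ x → ∃[ u ] st′ x ≡ st x ++ u

⊑-refl : ∀ {N} {st : State N} → st ⊑ st
⊑-refl {st = st} x = [] , sym (++-identityʳ (st x))

⊑-update : ∀ {N} {st st′ : State N} Q a → update st Q a ⊑ st′ → st ⊑ st′
⊑-update {st = st} Q a ext x with u , e ← ext x = (a xor Q x) ∷ u , trans e (++-assoc (st x) _ u)

Eliminated : (R : BinStr → Set) → ∀ {N} → Fin N → Fin N → State N → Set
Eliminated R y z st = ¬ R (st y) ⊎ ¬ R (st z)

module _ {R : BinStr → Set} where

  wins-after : ∀ {N} {P : State N → Set} {st} → Forces P st →
    (∀ {st′} → st ⊑ st′ → P st′ → SeekerWinsFrom R st′) → SeekerWinsFrom R st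
  wins-after (stop p) k = k ⊑-refl p
  wins-after (query Q f) k = ask Q (λ a → wins-after (f a) (k ∘ ⊑-update Q a))

  wins-by-elimination : (∀ w u → R (w ++ u) → R w) →
    (∀ {N} {st : State N} {y z} → y ≢ z → Forces (Eliminated R y z) st) → ∀ N → SeekerWinsFor R N
  wins-by-elimination R-++⁻ eliminate N = from-cover (allFin N) (λ x _ → ∈-allFin x)
    where
    Cover : List (Fin N) → State N → Set
    Cover L st = ∀ x → R (st x) → x ∈ L

    narrow : ∀ {L L′ st} → Cover L st → (∀ {x} → R (st x) → x ∈ L → x ∈ L′) → Cover L′ st
    narrow c f x rx = f rx (c x rx)

    cover-⊑ : ∀ {L st st′} → st ⊑ st′ → Cover L st → Cover L st′
    cover-⊑ {st = st} ext c x rx with u , e ← ext x = c x (R-++⁻ (st x) u (subst R e rx))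

    from-cover-∷ : ∀ y L {st} → Cover (y ∷ L) st → SeekerWinsFrom R st
    from-cover-∷ y [] c = done (λ a b ra rb → trans (singleton⁻ (c a ra)) (sym (singleton⁻ (c b rb))))
    from-cover-∷ y (z ∷ L) c with y ≟ z
    ... | yes refl = from-cover-∷ y L (narrow c λ _ → λ { (here e) → here e ; (there p) → p })
    ... | no y≢z = wins-after (eliminate y≢z) continue
      where
      continue : ∀ {st′} → _ ⊑ st′ → Eliminated R y z st′ → SeekerWinsFrom R st′
      continue ext (inj₁ ¬ry) = from-cover-∷ z L (narrow (cover-⊑ ext c) λ rx →
        λ { (here refl) → ⊥-elim (¬ry rx) ; (there p) → p })
      continue ext (inj₂ ¬rz) = from-cover-∷ y L (narrow (cover-⊑ ext c) λ rx →
        λ { (here e) → here e ; (there (here refl)) → ⊥-elim (¬rz rx) ; (there (there p)) → there p })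

    from-cover : ∀ L {st} → Cover L st → SeekerWinsFrom R st
    from-cover [] c = done (λ a _ ra _ → contradiction (c a ra) λ ())
    from-cover (y ∷ L) c = from-cover-∷ y L c

module Seeker (K : List ℕ) (0∈K : 0 ∈ K) where

  open Blocks K

  Separable : ℕ → Set
  Separable k = ∀ {N} {st : State N} {y z} → y ≢ z →
    EndsIn01^ 0 (st y) → EndsIn01^ k (st z) → Forces (Eliminated R y z) st

  eliminated-swap : ∀ {N} {st : State N} {y z} → Forces (Eliminated R z y) st → Forces (Eliminated R y z) st
  eliminated-swap = forces-map Sum.swap

  -- Ask about y alone: whoever receives the 0 either dies or starts a new run.
  ask-apart-at : ∀ {i j N} {st : State N} {y z} → y ≢ z → EndsIn01^ i (st y) → EndsIn01^ j (st z) →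
    i ∈ K ⊎ Separable (suc j) → j ∈ K ⊎ Separable (suc i) → Forces (Eliminated R y z) st
  ask-apart-at {st = st} {y} {z} y≢z ey ez y-case z-case = ask-apart y≢z answer
    where
    answer : ∀ b {st′} → st′ y ≡ st y ∷ʳ b → st′ z ≡ st z ∷ʳ not b →
      Forces (Eliminated R y z) st′
    answer false y0 z1 = Sum.[ (λ i∈K → stop (inj₁ (¬r-∷ʳ-false i∈K ey y0)))
                             , (λ sep → sep y≢z (st y , y0) (EndsIn01^-∷ʳ-true ez z1))
                             ] y-case
    answer true y1 z0 = Sum.[ (λ j∈K → stop (inj₂ (¬r-∷ʳ-false j∈K ez z0)))
                            , (λ sep → eliminated-swap
                                         (sep (y≢z ∘ sym) (st z , z0) (EndsIn01^-∷ʳ-true ey y1)))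
                            ] z-case

  separable-∈ : ∀ {k} → k ∈ K → Separable k
  separable-∈ k∈K y≢z ey ez = ask-apart-at y≢z ey ez (inj₁ 0∈K) (inj₁ k∈K)

  -- Answers that give both candidates a 0 only help the Seeker, so he can
  -- append the same run of 1s to both.
  lengthen : ∀ t {b N} {st : State N} {y z} → y ≢ z → EndsIn01^ 0 (st y) → EndsIn01^ b (st z) →
    Forces (λ st′ → Eliminated R y z st′ ⊎ (EndsIn01^ t (st′ y) × EndsIn01^ (t + b) (st′ z))) st
  lengthen zero y≢z ey ez = stop (inj₂ (ey , ez))
  lengthen (suc t) y≢z ey ez = forces-bind (lengthen t y≢z ey ez) λ
    { (inj₁ elim) → stop (inj₁ elim)
    ; (inj₂ (ey′ , ez′)) → query (λ _ → false) λ
        { true → stop (inj₂ (EndsIn01^-∷ʳ-true ey′ refl , EndsIn01^-∷ʳ-true ez′ refl))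
        ; false → forces-map inj₁ (separable-∈ 0∈K y≢z (_ , refl) (_ , refl))
        }
    }

  separable-∸ : ∀ {a b} → Separable a → Separable (a + b) → Separable b
  separable-∸ {zero} _ sep = sep
  separable-∸ {suc t} sa sab y≢z ey ez = forces-bind (lengthen t y≢z ey ez) λ
    { (inj₁ elim) → stop elim
    ; (inj₂ (ey′ , ez′)) → ask-apart-at y≢z ey′ ez′ (inj₂ sab) (inj₂ sa)
    }

  eliminate : Separable 1 → ∀ {N} {st : State N} {y z} → y ≢ z → Forces (Eliminated R y z) st
  eliminate sep₁ {st = st} y≢z = ask-apart y≢z λ
    { false y0 _ → from-0 y≢z (st _ , y0)
    ; true _ z0 → eliminated-swap (from-0 (y≢z ∘ sym) (st _ , z0))
    }
    where
    from-0 : ∀ {N} {st : State N} {y z} → y ≢ z → EndsIn01^ 0 (st y) → Forces (Eliminated R y z) st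
    from-0 y≢z ey = ask-apart y≢z λ
      { false y0 _ → stop (inj₁ (¬r-∷ʳ-false 0∈K ey y0))
      ; true y1 z0 → eliminated-swap (sep₁ (y≢z ∘ sym) (_ , z0) (EndsIn01^-∷ʳ-true ey y1))
      }

  seeker-wins : ∀ {m n} → m ∈ K → n ∈ K → gcd m n ≡ 1 → ∀ N → SeekerWinsFor R N
  seeker-wins m∈K n∈K gcd≡1 = wins-by-elimination r-++⁻ (eliminate sep₁)
    where
    sep₁ : Separable 1
    sep₁ = subst Separable gcd≡1 (gcd-closed Separable separable-∸ (separable-∈ m∈K) (separable-∈ n∈K))

module Obscurer (K : List ℕ) (d : ℕ) (d∣K : All (d ∣_) K) (d∤1 : ¬ d ∣ 1) where

  open Blocks K

  -- i ≢ j (mod d) for d ≠ 0, phrased without subtraction.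
  Apart : Maybe ℕ → Maybe ℕ → Set
  Apart (just i) (just j) = ∀ k → d ∣ k + i → d ∣ k + j → ⊥
  Apart _ _ = ⊤

  Safe : Maybe ℕ → Set
  Safe (just i) = ¬ d ∣ i
  Safe nothing = ⊤

  safe-∷ʳ-false : ∀ {w} → R w → Safe (trailingOnes w) → R (w ∷ʳ false)
  safe-∷ʳ-false {w} rw safe = r-∷ʳ-false rw λ k∈K ends →
    subst Safe (trailingOnes-EndsIn01^ ends) safe (lookup d∣K k∈K)

  apart-sym : ∀ {t₀ t₁} → Apart t₀ t₁ → Apart t₁ t₀
  apart-sym {just _} {just _} ap k a b = ap k b a
  apart-sym {just _} {nothing} _ = tt
  apart-sym {nothing} {just _} _ = tt
  apart-sym {nothing} {nothing} _ = tt

  apart-0 : ∀ {j} → ¬ d ∣ j → Apart (just 0) (just j)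
  apart-0 {j} d∤j k d∣k d∣k+j = d∤j (∣m+n∣m⇒∣n d∣k+j (subst (d ∣_) (ℕ.+-identityʳ k) d∣k))

  ∤-suc : ∀ {i} → d ∣ i → ¬ d ∣ suc i
  ∤-suc {i} d∣i d∣1+i = d∤1 (∣m+n∣m⇒∣n (subst (d ∣_) (ℕ.+-comm 1 i) d∣1+i) d∣i)

  apart-∷ʳ-true : ∀ {t₀ t₁} → Apart t₀ t₁ →
    Apart (stepTrailingOnes t₀ true) (stepTrailingOnes t₁ true)
  apart-∷ʳ-true {just i} {just j} ap k a b =
    ap (suc k) (subst (d ∣_) (ℕ.+-suc k i) a) (subst (d ∣_) (ℕ.+-suc k j) b)
  apart-∷ʳ-true {just _} {nothing} _ = tt
  apart-∷ʳ-true {nothing} _ = tt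

  apart-choice : ∀ t₀ t₁ → Apart t₀ t₁ →
    Safe t₀ × Apart (just 0) (stepTrailingOnes t₁ true) ⊎
    Safe t₁ × Apart (stepTrailingOnes t₀ true) (just 0)
  apart-choice (just i) (just j) ap with d ∣? i | d ∣? suc j
  ... | yes d∣i | _ = inj₂ ((λ d∣j → ap 0 d∣i d∣j) , apart-sym (apart-0 (∤-suc d∣i)))
  ... | no d∤i | yes d∣1+j =
    inj₂ ((λ d∣j → ∤-suc d∣j d∣1+j) , apart-sym (apart-0 (λ d∣1+i → ap 1 d∣1+i d∣1+j)))
  ... | no d∤i | no d∤1+j = inj₁ (d∤i , apart-0 d∤1+j)
  apart-choice (just i) nothing _ with d ∣? i
  ... | yes d∣i = inj₂ (tt , apart-sym (apart-0 (∤-suc d∣i)))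
  ... | no d∤i = inj₁ (d∤i , tt)
  apart-choice nothing (just j) _ with d ∣? j
  ... | yes d∣j = inj₁ (tt , apart-0 (∤-suc d∣j))
  ... | no d∤j = inj₂ (d∤j , tt)
  apart-choice nothing nothing _ = inj₁ (tt , tt)

  Invariant : BinStr → BinStr → Set
  Invariant w₀ w₁ = R w₀ × R w₁ × Apart (trailingOnes w₀) (trailingOnes w₁)

  invariant-∷ʳ-true : ∀ {w₀ w₁} → Invariant w₀ w₁ → Invariant (w₀ ∷ʳ true) (w₁ ∷ʳ true)
  invariant-∷ʳ-true {w₀} {w₁} (r₀ , r₁ , ap) = r-∷ʳ-true r₀ , r-∷ʳ-true r₁ ,
    subst₂ Apart (sym (trailingOnes-∷ʳ w₀ true)) (sym (trailingOnes-∷ʳ w₁ true)) (apart-∷ʳ-true ap)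

  invariant-split : ∀ {w₀ w₁} → Invariant w₀ w₁ →
    Invariant (w₀ ∷ʳ false) (w₁ ∷ʳ true) ⊎ Invariant (w₀ ∷ʳ true) (w₁ ∷ʳ false)
  invariant-split {w₀} {w₁} (r₀ , r₁ , ap) with apart-choice (trailingOnes w₀) (trailingOnes w₁) ap
  ... | inj₁ (safe₀ , ap′) = inj₁ (safe-∷ʳ-false r₀ safe₀ , r-∷ʳ-true r₁ ,
          subst₂ Apart (sym (trailingOnes-∷ʳ w₀ false)) (sym (trailingOnes-∷ʳ w₁ true)) ap′)
  ... | inj₂ (safe₁ , ap′) = inj₂ (r-∷ʳ-true r₀ , safe-∷ʳ-false r₁ safe₁ ,
          subst₂ Apart (sym (trailingOnes-∷ʳ w₀ true)) (sym (trailingOnes-∷ʳ w₁ false)) ap′)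

  answer : ∀ {w₀ w₁} q₀ q₁ → Invariant w₀ w₁ →
    ∃[ a ] Invariant (w₀ ∷ʳ (a xor q₀)) (w₁ ∷ʳ (a xor q₁))
  answer false false inv = true , invariant-∷ʳ-true inv
  answer true true inv = false , invariant-∷ʳ-true inv
  answer true false inv = Sum.[ true ,_ , false ,_ ] (invariant-split inv)
  answer false true inv = Sum.[ false ,_ , true ,_ ] (invariant-split inv)

  survives : ∀ {N} {st : State N} {y z} → y ≢ z → Invariant (st y) (st z) → ¬ SeekerWinsFrom R st
  survives y≢z (r₀ , r₁ , _) (done one) = y≢z (one _ _ r₀ r₁)
  survives {y = y} {z} y≢z inv (ask Q next)
    with a , inv′ ← answer (Q y) (Q z) inv = survives y≢z inv′ (next a)

  seeker-loses : ¬ SeekerWinsFor R 2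
  seeker-loses = survives {y = zero} {suc zero} (λ ()) (r-[] , r-[] , tt)

-- 00 is block 0, so S-mn m n is map block K on the nose.
theorem9 : (m n : ℕ) → 1 ≤ m → 1 ≤ n →
    (((N : ℕ) → 1 ≤ N → SeekerWinsFor (r (S-mn m n)) N) ⇔ (gcd m n ≡ 1))
theorem9 m n _ _ = mk⇔ coprime (λ gcd≡1 N _ → Seeker.seeker-wins K 0∈K m∈K n∈K gcd≡1 N)
  where
  K : List ℕ
  K = 0 ∷ m ∷ n ∷ []

  0∈K : 0 ∈ K
  0∈K = here refl

  m∈K : m ∈ K
  m∈K = there (here refl)

  n∈K : n ∈ K
  n∈K = there (there (here refl))

  coprime : ((N : ℕ) → 1 ≤ N → SeekerWinsFor (r (S-mn m n)) N) → gcd m n ≡ 1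
  coprime wins = decidable-stable (gcd m n ℕ.≟ 1) λ gcd≢1 →
    Obscurer.seeker-loses K (gcd m n) ((gcd m n ∣0) ∷ gcd[m,n]∣m m n ∷ gcd[m,n]∣n m n ∷ [])
      (gcd≢1 ∘ ∣1⇒≡1) (wins 2 (s≤s z≤n))
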